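{- Let $g \ge 1$ and let $G \subset \Sigma_g$ be a generalized graph cellularly embedded in $\Sigma_g$, having a complete left walk, having no left walk of length $1$ or $2$, and such that $V_r(G) = b(g) := 1+\sqrt{1+6g}$. Then $G$ is a complete graph on $S$ vertices, $S\equiv 1$ or $3 \pmod 6$, and $g=(S-1)(S-3)/6$. Moreover, the complete left walk of $G$ is an Eulerian circuit and all the other (non-complete) left walks have length $3$.
   Context: Generalized graphs are finite connected graphs with loops and multiple edges allowed; $S$, $A$ are the numbers of vertices and edges. $\Sigma_g$ is the closed oriented surface of genus $g$; an embedding is cellular if the complement is a disjoint union of open 2-cells. The embedding induces a polarization: at each vertex, oriented edges based there are cyclically ordered counterclockwise; this defines a permutation $\tau$ of oriented edges, $\tau(o,p)=(p,q)$ where $(p,q)$ immediately follows $(p,o)$ in the cyclic order at $p$. Orbits of $\tau$ are left walks; the length of a left walk is its number of oriented edges; a left walk is complete if it traverses every unoriented edge at least once. A reduced subgraph of $G$ has the same vertices, no loops, and exactly one edge of $G$ between any two distinct vertices joined in $G$; with $A_r(G)$ its number of edges, $V_r(G)=2A_r(G)/S$. -}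

module Defs where

open import Data.Nat using (ℕ; zero; suc; _+_; _*_; _∸_; _^_; _≤_; _<_)
open import Data.Bool using (Bool; true; false; not; if_then_else_; _∧_)
open import Data.Fin using (Fin; _≟_)
open import Data.List using (List; []; _∷_; concatMap; map; cartesianProduct)
open import Data.Bool.ListAction using (any)
open import Data.Nat.ListAction using (sum)
open import Data.List using () renaming (allFin to finList)
open import Data.Product using (Σ; ∃; _×_; _,_; proj₁; proj₂)
open import Data.Sum using (_⊎_)
open import Relation.Binary.PropositionalEquality using (_≡_; _≢_)
open import Relation.Nullary.Decidable using (⌊_⌋)
open import Function.Bundles using (_⇔_)

-- Oriented edges (darts) of a graph with A edges: edge e with one of its two orientations.
Dart : ℕ → Set
Dart A = Fin A × Bool

rev : ∀ {A} → Dart A → Dart A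
rev (e , b) = (e , not b)

edgeOf : ∀ {A} → Dart A → Fin A
edgeOf = proj₁

iter : ∀ {X : Set} → (X → X) → ℕ → X → X
iter f zero x = x
iter f (suc k) x = f (iter f k x)

data Walk {S A : ℕ} (src : Dart A → Fin S) : Fin S → Fin S → Set where
  here : ∀ {u} → Walk src u u
  step : ∀ {u v} (d : Dart A) → src d ≡ u → Walk src (src (rev d)) v → Walk src u v

-- A generalized graph (S vertices, A edges, loops / multiple edges allowed),
-- connected, together with a cellular embedding in the closed oriented surface of
-- genus g, given combinatorially by a rotation system (Heffter–Edmonds):
--  * src d   : the vertex at which the oriented edge d is based;
--  * σ d     : the oriented edge following d in the counterclockwise cyclic order at src d;
--    the σ-orbits are exactly the sets of darts based at a common vertex;
--  * faces (= left walks) are the orbits of τ = σ ∘ rev, counted by a labelling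
--    face : Dart A → Fin F whose fibres are exactly the τ-orbits;
--  * cellularity in Σ_g is encoded by Euler's formula S - A + F = 2 - 2g.
record EmbeddedGraph (S A g : ℕ) : Set where
  field
    src        : Dart A → Fin S
    σ          : Dart A → Dart A
    σ⁻¹        : Dart A → Dart A
    σσ⁻¹       : ∀ d → σ (σ⁻¹ d) ≡ d
    σ⁻¹σ       : ∀ d → σ⁻¹ (σ d) ≡ d
    vertexOrbits : ∀ d d' → (src d ≡ src d') ⇔ (∃ λ k → iter σ k d ≡ d')
    srcSurj    : ∀ v → ∃ λ d → src d ≡ v
    connected  : ∀ u v → Walk src u v
    F          : ℕ
    face       : Dart A → Fin F
    faceOrbits : ∀ d d' → (face d ≡ face d') ⇔ (∃ λ k → iter (λ x → σ (rev x)) k d ≡ d')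
    faceSurj   : ∀ f → ∃ λ d → face d ≡ f
    euler      : S + F + 2 * g ≡ A + 2

module _ {S A g : ℕ} (G : EmbeddedGraph S A g) where
  open EmbeddedGraph G

  τ : Dart A → Dart A
  τ d = σ (rev d)

  CompleteLeftWalk : Dart A → Set
  CompleteLeftWalk d = ∀ (e : Fin A) → ∃ λ k → edgeOf (iter τ k d) ≡ e

  HasCompleteLeftWalk : Set
  HasCompleteLeftWalk = ∃ λ d → CompleteLeftWalk d

  NoLeftWalkOfLength1or2 : Set
  NoLeftWalkOfLength1or2 = ∀ d → (τ d ≢ d) × (τ (τ d) ≢ d)

  LeftWalkLength3 : Dart A → Set
  LeftWalkLength3 d = (τ d ≢ d) × (τ (τ d) ≢ d) × (iter τ 3 d ≡ d)

  EulerianLeftWalk : Dart A → Set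
  EulerianLeftWalk d =
    (iter τ A d ≡ d) × (∀ (i j : Fin A) →
      edgeOf (iter τ (Data.Fin.toℕ i) d) ≡ edgeOf (iter τ (Data.Fin.toℕ j) d) → i ≡ j)

  Adjacent : Fin S → Fin S → Set
  Adjacent u v = ∃ λ (d : Dart A) → (src d ≡ u) × (src (rev d) ≡ v)

  dartList : List (Dart A)
  dartList = concatMap (λ e → (e , true) ∷ (e , false) ∷ []) (finList A)

  adjacentB : Fin S → Fin S → Bool
  adjacentB u v = any (λ d → ⌊ src d ≟ u ⌋ ∧ ⌊ src (rev d) ≟ v ⌋) dartList

  -- Number of ordered pairs (u , v) of distinct adjacent vertices;
  -- this equals 2·A_r(G), twice the number of edges of a reduced subgraph.
  twoAr : ℕ
  twoAr = sum (map (λ p → if not ⌊ proj₁ p ≟ proj₂ p ⌋ ∧ adjacentB (proj₁ p) (proj₂ p)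
                           then 1 else 0)
                   (cartesianProduct (finList S) (finList S)))

  -- V_r(G) = 2 A_r / S equals b(g) = 1 + √(1 + 6g), written without reals:
  -- (2A_r − S)/S = √(1+6g)  ⇔  S ≤ 2A_r  and  (2A_r − S)² = S²(1 + 6g)   (S > 0).
  VrEqualsB : Set
  VrEqualsB = (S ≤ twoAr) × ((twoAr ∸ S) ^ 2 ≡ (S ^ 2) * (1 + 6 * g))

  IsCompleteGraph : Set
  IsCompleteGraph =
    (∀ (e : Fin A) → src (e , true) ≢ src (e , false))
    × (∀ (e e' : Fin A) →
         ((src (e , true) ≡ src (e' , true)) × (src (e , false) ≡ src (e' , false))
          ⊎ (src (e , true) ≡ src (e' , false)) × (src (e , false) ≡ src (e' , true)))
         → e ≡ e')
    × (∀ (u v : Fin S) → u ≢ v → Adjacent u v)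

-- Let T = 2A_r. Every ordered pair of distinct adjacent vertices is witnessed by a non-loop dart, so
-- T ≤ 2A, and T ≤ S(S − 1). A complete left walk has length at least A and every other at least 3;
-- since the lengths add up to 2A this gives 3F ≤ A + 3, hence 2A + 3 ≤ 3S + 6g by Euler's formula.
-- Writing m = T − S, the hypothesis V_r = b(g) says m² = S²(1 + 6g), and together with the two upper
-- bounds on T this forces m + 2S = S², i.e. T = S(S − 1) and 1 + 6g = (S − 2)². Then every inequality
-- above is an equality: G is a simple complete graph, the complete walk has exactly A darts (so it is
-- an Eulerian circuit) and all the other left walks are triangles.
module Submission where

open import Defs
open import Data.Bool using (Bool; true; false; not; if_then_else_; _∧_)
open import Data.Bool.Properties
  using (∧-conicalˡ; ∧-conicalʳ; ∧-identityʳ; not-involutive; T-≡; T-∧) renaming (_≟_ to _≟ᵇ_)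
open import Data.Empty using (⊥-elim)
open import Data.Fin using (Fin; zero; suc; toℕ; fromℕ<; _≟_)
open import Data.Fin.Properties
  using (suc-injective; toℕ-injective; toℕ<n; toℕ-fromℕ<; injective⇒≤; nonZeroIndex)
open import Data.List using (List; []; _∷_; _++_; map; concatMap; tabulate; cartesianProduct; allFin)
open import Data.List.Properties using (map-++; map-cong; map-∘)
open import Data.List.Membership.Propositional using (_∈_)
open import Data.List.Membership.Propositional.Properties using (∈-allFin; ∈-concatMap⁺)
open import Data.List.Relation.Unary.Any as Any using (here; there)
open import Data.List.Relation.Unary.Any.Properties using (any⁻)
open import Data.Nat
  using (ℕ; zero; suc; _+_; _*_; _∸_; _^_; _≤_; _<_; _%_; _/_; z≤n; s≤s; s≤s⁻¹; NonZero; >-nonZero; >-nonZero⁻¹)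
open import Data.Nat.DivMod using (m≡m%n+[m/n]*n; m%n<n; [m+kn]%n≡m%n)
open import Data.Nat.ListAction using (sum)
open import Data.Nat.ListAction.Properties using (sum-++)
open import Data.Nat.Properties hiding (_≟_; suc-injective)
open import Data.Nat.Tactic.RingSolver using (solve; solve-∀)
open import Data.Product using (∃; _×_; _,_; proj₁; proj₂)
open import Data.Product.Properties using (≡-dec)
open import Data.Sum using (_⊎_; inj₁; inj₂)
open import Function using (_∘_; case_of_)
open import Function.Bundles using (Equivalence)
open import Function.Definitions using (Injective)
open import Relation.Binary.Definitions using (DecidableEquality; tri<; tri≈; tri>)
open import Relation.Binary.PropositionalEquality
open import Relation.Nullary using (¬_; Dec; yes; no)
open import Relation.Nullary.Decidable using (⌊_⌋; ⌊⌋-map′; isYes≗does; dec-true; dec-false; toWitness)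
open import Algebra.Properties.CommutativeMonoid.Sum +-0-commutativeMonoid
  using (sum-syntax; sum-cong-≗; ∑-distrib-+)
open import Algebra.Properties.CommutativeSemigroup +-commutativeSemigroup using (x∙yz≈y∙xz)

⌊⌋-true : ∀ {P : Set} (p? : Dec P) → P → ⌊ p? ⌋ ≡ true
⌊⌋-true p? p = trans (isYes≗does p?) (dec-true p? p)

⌊⌋-false : ∀ {P : Set} (p? : Dec P) → ¬ P → ⌊ p? ⌋ ≡ false
⌊⌋-false p? ¬p = trans (isYes≗does p?) (dec-false p? ¬p)

not⌊⌋-true⁻ : ∀ {P : Set} (p? : Dec P) → not ⌊ p? ⌋ ≡ true → ¬ P
not⌊⌋-true⁻ p? ¬p p = case trans (sym ¬p) (cong not (⌊⌋-true p? p)) of λ ()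

⟦_⟧ : Bool → ℕ
⟦ b ⟧ = if b then 1 else 0

⟦⟧≤1 : ∀ b → ⟦ b ⟧ ≤ 1
⟦⟧≤1 true  = ≤-refl
⟦⟧≤1 false = z≤n

⟦∧⟧≤⟦⟧ : ∀ b c → ⟦ b ∧ c ⟧ ≤ ⟦ b ⟧
⟦∧⟧≤⟦⟧ true  c = ⟦⟧≤1 c
⟦∧⟧≤⟦⟧ false c = z≤n

⟦⟧≡1⇒true : ∀ {b} → ⟦ b ⟧ ≡ 1 → b ≡ true
⟦⟧≡1⇒true {true} _ = refl

⟦⟧≤ : ∀ {b n} → (b ≡ true → 1 ≤ n) → ⟦ b ⟧ ≤ n
⟦⟧≤ {true}  1≤n = 1≤n refl
⟦⟧≤ {false} _   = z≤n

⟦∧⟧ : ∀ b c → ⟦ b ∧ c ⟧ ≡ (if b then ⟦ c ⟧ else 0)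
⟦∧⟧ true  c = refl
⟦∧⟧ false c = refl

-- Sums and counting

∑-const : ∀ n c → ∑[ i < n ] c ≡ n * c
∑-const zero    c = refl
∑-const (suc n) c = cong (c +_) (∑-const n c)

∑-mono-≤ : ∀ {n} {f g : Fin n → ℕ} → (∀ i → f i ≤ g i) → ∑[ i < n ] f i ≤ ∑[ i < n ] g i
∑-mono-≤ {zero}  f≤g = z≤n
∑-mono-≤ {suc n} {f} {g} f≤g = +-mono-≤ (f≤g zero) (∑-mono-≤ {f = f ∘ suc} {g = g ∘ suc} (f≤g ∘ suc))

+-mono-≤-≡ : ∀ {a b c d} → a ≤ b → c ≤ d → a + c ≡ b + d → a ≡ b × c ≡ d
+-mono-≤-≡ {a} {b} {c} {d} a≤b c≤d eq = a≡b , +-cancelˡ-≡ a c d (trans eq (cong (_+ d) (sym a≡b)))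
  where
  a≡b : a ≡ b
  a≡b = ≤-antisym a≤b (+-cancelʳ-≤ c b a (≤-trans (+-monoʳ-≤ b c≤d) (≤-reflexive (sym eq))))

∑-mono-≤-≡⇒≗ : ∀ {n} {f g : Fin n → ℕ} → (∀ i → f i ≤ g i) →
  ∑[ i < n ] f i ≡ ∑[ i < n ] g i → ∀ i → f i ≡ g i
∑-mono-≤-≡⇒≗ {suc n} {f} {g} f≤g eq i
  with +-mono-≤-≡ (f≤g zero) (∑-mono-≤ {f = f ∘ suc} {g = g ∘ suc} (f≤g ∘ suc)) eq
... | f₀≡g₀ , rest≡ with i
...   | zero  = f₀≡g₀
...   | suc j = ∑-mono-≤-≡⇒≗ {f = f ∘ suc} {g = g ∘ suc} (f≤g ∘ suc) rest≡ j

-- ⌊ suc a ≟ suc i ⌋ is not definitionally ⌊ a ≟ i ⌋ (⌊_⌋ is isYes, not does); ⌊⌋-map′ bridges it.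
∑-select : ∀ {n} (a : Fin n) (h : Fin n → ℕ) → ∑[ i < n ] (if ⌊ a ≟ i ⌋ then h i else 0) ≡ h a
∑-select {suc n} zero    h = trans (cong (h zero +_) (∑-const n 0)) (trans (cong (h zero +_) (*-zeroʳ n)) (+-identityʳ _))
∑-select {suc n} (suc a) h =
  trans (sum-cong-≗ {n} λ i → cong (λ b → if b then h (suc i) else 0) (⌊⌋-map′ _ _ (a ≟ i))) (∑-select a (h ∘ suc))

∑-select-or-const : ∀ {n} (a : Fin n) x y → ∑[ i < n ] (if ⌊ a ≟ i ⌋ then x else y) + y ≡ x + n * y
∑-select-or-const {suc n} zero x y = begin
  x + ∑[ i < n ] y + y                              ≡⟨ cong (λ s → x + s + y) (∑-const n y) ⟩
  x + n * y + y                                     ≡⟨ +-assoc x (n * y) y ⟩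
  x + (n * y + y)                                   ≡⟨ cong (x +_) (+-comm (n * y) y) ⟩
  x + (y + n * y)                                   ∎
  where open ≡-Reasoning
∑-select-or-const {suc n} (suc a) x y = begin
  y + ∑[ i < n ] (if ⌊ suc a ≟ suc i ⌋ then x else y) + y
    ≡⟨ cong (λ s → y + s + y) (sum-cong-≗ {n} λ i → cong (λ b → if b then x else y) (⌊⌋-map′ _ _ (a ≟ i))) ⟩
  y + ∑[ i < n ] (if ⌊ a ≟ i ⌋ then x else y) + y   ≡⟨ +-assoc y _ y ⟩
  y + (∑[ i < n ] (if ⌊ a ≟ i ⌋ then x else y) + y) ≡⟨ cong (y +_) (∑-select-or-const a x y) ⟩
  y + (x + n * y)                                   ≡⟨ x∙yz≈y∙xz y x (n * y) ⟩
  x + (y + n * y)                                   ∎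
  where open ≡-Reasoning

∑-if : ∀ {n} b (h : Fin n → ℕ) → ∑[ i < n ] (if b then h i else 0) ≡ (if b then ∑[ i < n ] h i else 0)
∑-if {n} true  h = refl
∑-if {n} false h = trans (∑-const n 0) (*-zeroʳ n)

∑∑-mono-≤-≡⇒≗ : ∀ {m n} {f g : Fin m → Fin n → ℕ} → (∀ i j → f i j ≤ g i j) →
  ∑[ i < m ] ∑[ j < n ] f i j ≡ ∑[ i < m ] ∑[ j < n ] g i j → ∀ i j → f i j ≡ g i j
∑∑-mono-≤-≡⇒≗ {m} {n} {f} {g} f≤g eq i =
  ∑-mono-≤-≡⇒≗ {n} (f≤g i) (∑-mono-≤-≡⇒≗ {m} {λ i → ∑[ j < n ] f i j} (λ i → ∑-mono-≤ {n} (f≤g i)) eq i)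

⟦not⟧+⟦⟧≡1 : ∀ b → ⟦ not b ⟧ + ⟦ b ⟧ ≡ 1
⟦not⟧+⟦⟧≡1 true  = refl
⟦not⟧+⟦⟧≡1 false = refl

∑-⟦≢⟧ : ∀ {n} (i : Fin n) → ∑[ j < n ] ⟦ not ⌊ i ≟ j ⌋ ⟧ + 1 ≡ n
∑-⟦≢⟧ {n} i = begin
  ∑[ j < n ] ⟦ not ⌊ i ≟ j ⌋ ⟧ + 1
    ≡⟨ cong (∑[ j < n ] ⟦ not ⌊ i ≟ j ⌋ ⟧ +_) (∑-select i (λ _ → 1)) ⟨
  ∑[ j < n ] ⟦ not ⌊ i ≟ j ⌋ ⟧ + ∑[ j < n ] ⟦ ⌊ i ≟ j ⌋ ⟧
    ≡⟨ ∑-distrib-+ (λ j → ⟦ not ⌊ i ≟ j ⌋ ⟧) _ ⟨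
  ∑[ j < n ] (⟦ not ⌊ i ≟ j ⌋ ⟧ + ⟦ ⌊ i ≟ j ⌋ ⟧)
    ≡⟨ sum-cong-≗ {n} (λ j → ⟦not⟧+⟦⟧≡1 ⌊ i ≟ j ⌋) ⟩
  ∑[ j < n ] 1
    ≡⟨ ∑-const n 1 ⟩
  n * 1
    ≡⟨ *-identityʳ n ⟩
  n ∎
  where open ≡-Reasoning

∑∑-⟦≢⟧ : ∀ n → ∑[ i < n ] ∑[ j < n ] ⟦ not ⌊ i ≟ j ⌋ ⟧ + n ≡ n * n
∑∑-⟦≢⟧ n = begin
  ∑[ i < n ] ∑[ j < n ] ⟦ not ⌊ i ≟ j ⌋ ⟧ + n
    ≡⟨ cong (∑[ i < n ] ∑[ j < n ] ⟦ not ⌊ i ≟ j ⌋ ⟧ +_) (trans (sym (*-identityʳ n)) (sym (∑-const n 1))) ⟩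
  ∑[ i < n ] ∑[ j < n ] ⟦ not ⌊ i ≟ j ⌋ ⟧ + ∑[ i < n ] 1
    ≡⟨ ∑-distrib-+ (λ i → ∑[ j < n ] ⟦ not ⌊ i ≟ j ⌋ ⟧) _ ⟨
  ∑[ i < n ] (∑[ j < n ] ⟦ not ⌊ i ≟ j ⌋ ⟧ + 1)
    ≡⟨ sum-cong-≗ {n} ∑-⟦≢⟧ ⟩
  ∑[ i < n ] n
    ≡⟨ ∑-const n n ⟩
  n * n ∎
  where open ≡-Reasoning

sum-map-++ : ∀ {X : Set} (h : X → ℕ) xs ys → sum (map h (xs ++ ys)) ≡ sum (map h xs) + sum (map h ys)
sum-map-++ h xs ys = trans (cong sum (map-++ h xs ys)) (sum-++ (map h xs) (map h ys))

sum-map-concatMap : ∀ {X Y : Set} (h : Y → ℕ) (f : X → List Y) xs →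
  sum (map h (concatMap f xs)) ≡ sum (map (λ x → sum (map h (f x))) xs)
sum-map-concatMap h f []       = refl
sum-map-concatMap h f (x ∷ xs) = trans (sum-map-++ h (f x) _) (cong (_ +_) (sum-map-concatMap h f xs))

sum-map-cartesianProduct : ∀ {X Y : Set} (h : X × Y → ℕ) xs ys →
  sum (map h (cartesianProduct xs ys)) ≡ sum (map (λ x → sum (map (λ y → h (x , y)) ys)) xs)
sum-map-cartesianProduct h []       ys = refl
sum-map-cartesianProduct h (x ∷ xs) ys =
  trans (sum-map-++ h (map (x ,_) ys) _) (cong₂ _+_ (cong sum (sym (map-∘ ys))) (sum-map-cartesianProduct h xs ys))

sum-map-tabulate : ∀ {X : Set} {n} (h : X → ℕ) (f : Fin n → X) → sum (map h (tabulate f)) ≡ ∑[ i < n ] h (f i)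
sum-map-tabulate {n = zero}  h f = refl
sum-map-tabulate {n = suc n} h f = cong (h (f zero) +_) (sum-map-tabulate h (f ∘ suc))

∑-sum-map-comm : ∀ {X : Set} {n} (h : Fin n → X → ℕ) xs →
  ∑[ i < n ] sum (map (h i) xs) ≡ sum (map (λ x → ∑[ i < n ] h i x) xs)
∑-sum-map-comm {n = n} h []       = trans (∑-const n 0) (*-zeroʳ n)
∑-sum-map-comm {n = n} h (x ∷ xs) = trans (∑-distrib-+ (λ i → h i x) _) (cong (_ +_) (∑-sum-map-comm h xs))

count : ∀ {X : Set} → (X → Bool) → List X → ℕ
count p xs = sum (map (λ x → ⟦ p x ⟧) xs)

count-mono : ∀ {X : Set} {p q : X → Bool} xs → (∀ x → p x ≡ true → q x ≡ true) → count p xs ≤ count q xs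
count-mono []       p⇒q = z≤n
count-mono {p = p} {q} (x ∷ xs) p⇒q = +-mono-≤ (head-≤ (p x) refl) (count-mono xs p⇒q)
  where
  head-≤ : ∀ b → p x ≡ b → ⟦ b ⟧ ≤ ⟦ q x ⟧
  head-≤ true  px = ≤-reflexive (cong ⟦_⟧ (sym (p⇒q x px)))
  head-≤ false _  = z≤n

true⇒1≤count : ∀ {X : Set} {p : X → Bool} {x} xs → x ∈ xs → p x ≡ true → 1 ≤ count p xs
true⇒1≤count (x ∷ xs) (here refl) px rewrite px = s≤s z≤n
true⇒1≤count (y ∷ xs) (there x∈xs) px = ≤-trans (true⇒1≤count xs x∈xs px) (m≤n+m _ _)

module _ {X : Set} (_≟ₓ_ : DecidableEquality X) where

  count-remove : ∀ {p : X → Bool} {x} xs → x ∈ xs → p x ≡ true →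
    suc (count (λ y → p y ∧ not ⌊ y ≟ₓ x ⌋) xs) ≤ count p xs
  count-remove {p} {x} (x ∷ xs) (here refl) px with x ≟ₓ x
  ... | no x≢x = ⊥-elim (x≢x refl)
  ... | yes _ rewrite px = s≤s (count-mono xs λ y → ∧-conicalˡ (p y) _)
  count-remove {p} {x} (y ∷ xs) (there x∈xs) px =
    ≤-trans (≤-reflexive (sym (+-suc _ _))) (+-mono-≤ (⟦∧⟧≤⟦⟧ (p y) _) (count-remove xs x∈xs px))

  injective⇒≤count : ∀ {m} {p : X → Bool} {xs} (f : Fin m → X) → Injective _≡_ _≡_ f →
    (∀ i → p (f i) ≡ true) → (∀ i → f i ∈ xs) → m ≤ count p xs
  injective⇒≤count {zero}  f f-inj pf f∈xs = z≤n
  injective⇒≤count {suc m} {p} {xs} f f-inj pf f∈xs =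
    ≤-trans (s≤s (injective⇒≤count (f ∘ suc) (suc-injective ∘ f-inj) pf′ (f∈xs ∘ suc)))
            (count-remove xs (f∈xs zero) (pf zero))
    where
    pf′ : ∀ i → p (f (suc i)) ∧ not ⌊ f (suc i) ≟ₓ f zero ⌋ ≡ true
    pf′ i with f (suc i) ≟ₓ f zero
    ... | yes fi≡f₀ = case f-inj fi≡f₀ of λ ()
    ... | no _      = trans (∧-identityʳ _) (pf (suc i))

  distinct⇒2≤count : ∀ {p : X → Bool} {x y} xs → x ∈ xs → y ∈ xs → x ≢ y → p x ≡ true → p y ≡ true →
    2 ≤ count p xs
  distinct⇒2≤count {p} {x} {y} xs x∈xs y∈xs x≢y px py =
    ≤-trans (s≤s (true⇒1≤count xs y∈xs (cong₂ _∧_ py (cong not (⌊⌋-false (y ≟ₓ x) (x≢y ∘ sym))))))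
            (count-remove xs x∈xs px)

-- Iterates

iter-+ : ∀ {X : Set} (f : X → X) m n x → iter f (m + n) x ≡ iter f m (iter f n x)
iter-+ f zero    n x = refl
iter-+ f (suc m) n x = cong f (iter-+ f m n x)

iter-injective : ∀ {X : Set} {f : X → X} → Injective _≡_ _≡_ f → ∀ n → Injective _≡_ _≡_ (iter f n)
iter-injective f-inj zero    eq = eq
iter-injective f-inj (suc n) eq = iter-injective f-inj n (f-inj eq)

iter-*-fixed : ∀ {X : Set} (f : X → X) {p x} → iter f p x ≡ x → ∀ q → iter f (q * p) x ≡ x
iter-*-fixed f         fix zero    = refl
iter-*-fixed f {p} {x} fix (suc q) = trans (iter-+ f p (q * p) x) (trans (cong (iter f p) (iter-*-fixed f fix q)) fix)

iter-% : ∀ {X : Set} (f : X → X) {p x} → iter f (suc p) x ≡ x → ∀ n → iter f n x ≡ iter f (n % suc p) x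
iter-% f {p} {x} fix n = begin
  iter f n x                                       ≡⟨ cong (λ k → iter f k x) (m≡m%n+[m/n]*n n (suc p)) ⟩
  iter f (n % suc p + n / suc p * suc p) x          ≡⟨ iter-+ f (n % suc p) _ x ⟩
  iter f (n % suc p) (iter f (n / suc p * suc p) x) ≡⟨ cong (iter f (n % suc p)) (iter-*-fixed f fix (n / suc p)) ⟩
  iter f (n % suc p) x                              ∎
  where open ≡-Reasoning

iter-∸-fixed : ∀ {X : Set} {f : X → X} → Injective _≡_ _≡_ f → ∀ {m n x} → m ≤ n →
  iter f m x ≡ iter f n x → iter f (n ∸ m) x ≡ x
iter-∸-fixed {f = f} f-inj {m} {n} {x} m≤n eq = sym (iter-injective f-inj m (begin
  iter f m x                 ≡⟨ eq ⟩
  iter f n x                 ≡⟨ cong (λ k → iter f k x) (sym (m+[n∸m]≡n m≤n)) ⟩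
  iter f (m + (n ∸ m)) x     ≡⟨ iter-+ f m (n ∸ m) x ⟩
  iter f m (iter f (n ∸ m) x) ∎))
  where open ≡-Reasoning

NoPeriodBelow : ∀ {X : Set} → (X → X) → ℕ → X → Set
NoPeriodBelow f n x = ∀ p → 0 < p → p < n → iter f p x ≢ x

iterates-injective : ∀ {X : Set} {f : X → X} {n x} → Injective _≡_ _≡_ f → NoPeriodBelow f n x →
  Injective _≡_ _≡_ (λ (i : Fin n) → iter f (toℕ i) x)
iterates-injective {n = n} f-inj noPeriod {i} {j} eq with <-cmp (toℕ i) (toℕ j)
... | tri≈ _ i≡j _ = toℕ-injective i≡j
... | tri< i<j _ _ = ⊥-elim (noPeriod _ (m<n⇒0<n∸m i<j) (≤-<-trans (m∸n≤m (toℕ j) (toℕ i)) (toℕ<n j))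
                                       (iter-∸-fixed f-inj (<⇒≤ i<j) eq))
... | tri> _ _ j<i = ⊥-elim (noPeriod _ (m<n⇒0<n∸m j<i) (≤-<-trans (m∸n≤m (toℕ i) (toℕ j)) (toℕ<n i))
                                       (iter-∸-fixed f-inj (<⇒≤ j<i) (sym eq)))

-- Arithmetic

square : ∀ x → x ^ 2 ≡ x * x
square x = cong (x *_) (*-identityʳ x)

2A+3≤3S+6g : ∀ {S A F g} → 3 * F ≤ A + 3 → S + F + 2 * g ≡ A + 2 → 2 * A + 3 ≤ 3 * S + 6 * g
2A+3≤3S+6g {S} {A} {F} {g} 3F≤A+3 euler = +-cancelʳ-≤ (A + 3) _ _ (begin
  2 * A + 3 + (A + 3)      ≡⟨ solve (A ∷ []) ⟩
  3 * (A + 2)              ≡⟨ cong (3 *_) euler ⟨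
  3 * (S + F + 2 * g)      ≡⟨ solve (S ∷ F ∷ g ∷ []) ⟩
  3 * S + 6 * g + 3 * F    ≤⟨ +-monoʳ-≤ (3 * S + 6 * g) 3F≤A+3 ⟩
  3 * S + 6 * g + (A + 3)  ∎)
  where open ≤-Reasoning

3F≡A+3 : ∀ {S A F g} → S + F + 2 * g ≡ A + 2 → 2 * A + 3 ≡ 3 * S + 6 * g → 3 * F ≡ A + 3
3F≡A+3 {S} {A} {F} {g} euler 2A+3≡ = +-cancelˡ-≡ (2 * A + 3) _ _ (begin
  2 * A + 3 + 3 * F        ≡⟨ cong (_+ 3 * F) 2A+3≡ ⟩
  3 * S + 6 * g + 3 * F    ≡⟨ solve (S ∷ F ∷ g ∷ []) ⟩
  3 * (S + F + 2 * g)      ≡⟨ cong (3 *_) euler ⟩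
  3 * (A + 2)              ≡⟨ solve (A ∷ []) ⟩
  2 * A + 3 + (A + 3)      ∎)
  where open ≡-Reasoning

2S<m : ∀ {S m k} → 1 ≤ S → 7 ≤ k → m * m ≡ S * S * k → 2 * S < m
2S<m {S} {m} {k} 1≤S 7≤k m²≡S²k = ≰⇒> λ m≤2S → <-irrefl refl (begin-strict
  S * S * 7        ≤⟨ *-monoʳ-≤ (S * S) 7≤k ⟩
  S * S * k        ≡⟨ m²≡S²k ⟨
  m * m            ≤⟨ *-mono-≤ m≤2S m≤2S ⟩
  2 * S * (2 * S)  ≡⟨ solve (S ∷ []) ⟩
  S * S * 4        <⟨ *-monoʳ-< (S * S) {4} {7} (s≤s (s≤s (s≤s (s≤s (s≤s z≤n))))) ⟩
  S * S * 7        ∎)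
  where
  open ≤-Reasoning
  instance
    S*S≢0 : NonZero (S * S)
    S*S≢0 = >-nonZero (*-mono-≤ 1≤S 1≤S)

-- Multiply m + 4 ≤ 2S + k by S² = m + 2S + b, then use S²k = m² and S² = m + 2S + b again.
gap*m≤gap*2S : ∀ {S m b k} → S * S ≡ m + 2 * S + b → m * m ≡ S * S * k → m + 4 ≤ 2 * S + k →
  b * m ≤ b * (2 * S)
gap*m≤gap*2S {S} {m} {b} {k} S²≡ m²≡S²k m+4≤ = +-cancelˡ-≤ X _ _ (begin
  X + b * m                                     ≡⟨⟩
  m * m + 4 * m + 2 * S * m + 8 * S + 4 * b + b * m ≡⟨ solve (S ∷ m ∷ b ∷ []) ⟩
  (m + 2 * S + b) * (m + 4)                     ≡⟨ cong (_* (m + 4)) S²≡ ⟨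
  S * S * (m + 4)                               ≤⟨ *-monoʳ-≤ (S * S) m+4≤ ⟩
  S * S * (2 * S + k)                           ≡⟨ solve (S ∷ k ∷ []) ⟩
  2 * S * (S * S) + S * S * k                   ≡⟨ cong₂ (λ x y → 2 * S * x + y) S²≡ (sym m²≡S²k) ⟩
  2 * S * (m + 2 * S + b) + m * m               ≡⟨ solve (S ∷ m ∷ b ∷ []) ⟩
  m * m + 2 * S * m + 2 * S * b + 4 * (S * S)   ≡⟨ cong (λ x → m * m + 2 * S * m + 2 * S * b + 4 * x) S²≡ ⟩
  m * m + 2 * S * m + 2 * S * b + 4 * (m + 2 * S + b) ≡⟨ solve (S ∷ m ∷ b ∷ []) ⟩
  m * m + 4 * m + 2 * S * m + 8 * S + 4 * b + b * (2 * S) ≡⟨⟩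
  X + b * (2 * S)                               ∎)
  where
  open ≤-Reasoning
  X : ℕ
  X = m * m + 4 * m + 2 * S * m + 8 * S + 4 * b

-- The gap b = S² − (m + 2S) satisfies b m ≤ 2 b S, while m > 2S; so b = 0.
square-gap : ∀ {S m k} → 1 ≤ S → 7 ≤ k → m * m ≡ S * S * k → m + 2 * S ≤ S * S → m + 4 ≤ 2 * S + k →
  m + 2 * S ≡ S * S
square-gap {S} {m} {k} 1≤S 7≤k m²≡S²k m+2S≤S² m+4≤ = begin
  m + 2 * S                               ≡⟨ +-identityʳ _ ⟨
  m + 2 * S + 0                           ≡⟨ cong (m + 2 * S +_) gap≡0 ⟨
  m + 2 * S + (S * S ∸ (m + 2 * S))       ≡⟨ m+[n∸m]≡n m+2S≤S² ⟩
  S * S                                   ∎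
  where
  open ≡-Reasoning
  gap≡0 : S * S ∸ (m + 2 * S) ≡ 0
  gap≡0 with S * S ∸ (m + 2 * S)
             | gap*m≤gap*2S {S} {m} {S * S ∸ (m + 2 * S)} {k} (sym (m+[n∸m]≡n m+2S≤S²)) m²≡S²k m+4≤
  ... | zero  | _ = refl
  ... | suc b | b*m≤b*2S = ⊥-elim (<⇒≱ (2S<m 1≤S 7≤k m²≡S²k) (*-cancelˡ-≤ (suc b) b*m≤b*2S))

square-root : ∀ {S m k} → 1 ≤ S → S * S ≡ m + 2 * S → m * m ≡ S * S * k →
  ∃ λ t → S ≡ 2 + t × m ≡ S * t × k ≡ t * t
square-root {1} {m} _ 1≡m+2 _ = case trans 1≡m+2 (+-comm m 2) of λ ()
square-root {suc (suc t)} {m} {k} _ S²≡m+2S m²≡S²k = t , refl , m≡St , k≡t²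
  where
  S : ℕ
  S = 2 + t
  m≡St : m ≡ S * t
  m≡St = +-cancelʳ-≡ (2 * S) m (S * t) (trans (sym S²≡m+2S) (S²≡St+2S t))
    where
    S²≡St+2S : ∀ t → (2 + t) * (2 + t) ≡ (2 + t) * t + 2 * (2 + t)
    S²≡St+2S = solve-∀
  k≡t² : k ≡ t * t
  k≡t² = *-cancelˡ-≡ k (t * t) (S * S) (begin
    S * S * k        ≡⟨ m²≡S²k ⟨
    m * m            ≡⟨ cong₂ _*_ m≡St m≡St ⟩
    S * t * (S * t)  ≡⟨ [St]²≡S²t² t ⟩
    S * S * (t * t)  ∎)
    where
    open ≡-Reasoning
    [St]²≡S²t² : ∀ t → (2 + t) * t * ((2 + t) * t) ≡ (2 + t) * (2 + t) * (t * t)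
    [St]²≡S²t² = solve-∀

OneOrThreeMod6 : ℕ → Set
OneOrThreeMod6 n = n % 6 ≡ 1 ⊎ n % 6 ≡ 3

t²%6≡1⇒OneOrThreeMod6[2+t] : ∀ t → (t * t) % 6 ≡ 1 → OneOrThreeMod6 (2 + t)
t²%6≡1⇒OneOrThreeMod6[2+t] 0 ()
t²%6≡1⇒OneOrThreeMod6[2+t] 1 _ = inj₂ refl
t²%6≡1⇒OneOrThreeMod6[2+t] 2 ()
t²%6≡1⇒OneOrThreeMod6[2+t] 3 ()
t²%6≡1⇒OneOrThreeMod6[2+t] 4 ()
t²%6≡1⇒OneOrThreeMod6[2+t] 5 _ = inj₁ refl
t²%6≡1⇒OneOrThreeMod6[2+t] (suc (suc (suc (suc (suc (suc t)))))) t²%6≡1 =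
  subst (λ r → r ≡ 1 ⊎ r ≡ 3) (sym shift) (t²%6≡1⇒OneOrThreeMod6[2+t] t (trans (sym shift²) t²%6≡1))
  where
  shift : (2 + (6 + t)) % 6 ≡ (2 + t) % 6
  shift = trans (cong (_% 6) (rearrange t)) ([m+kn]%n≡m%n (2 + t) 1 6)
    where
    rearrange : ∀ t → 2 + (6 + t) ≡ 2 + t + 1 * 6
    rearrange = solve-∀
  shift² : ((6 + t) * (6 + t)) % 6 ≡ (t * t) % 6
  shift² = trans (cong (_% 6) (expand t)) ([m+kn]%n≡m%n (t * t) (6 + 2 * t) 6)
    where
    expand : ∀ t → (6 + t) * (6 + t) ≡ t * t + (6 + 2 * t) * 6
    expand = solve-∀

[T∸S]+2S≡T+S : ∀ {S T} → S ≤ T → T ∸ S + 2 * S ≡ T + S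
[T∸S]+2S≡T+S {S} {T} S≤T = begin
  T ∸ S + 2 * S        ≡⟨ cong (T ∸ S +_) (cong (S +_) (+-identityʳ S)) ⟩
  T ∸ S + (S + S)      ≡⟨ +-assoc (T ∸ S) S S ⟨
  T ∸ S + S + S        ≡⟨ cong (_+ S) (m∸n+n≡m S≤T) ⟩
  T + S                ∎
  where open ≡-Reasoning

Vr≡b⇒m²≡S²k : ∀ {S T k} → (T ∸ S) ^ 2 ≡ S ^ 2 * k → (T ∸ S) * (T ∸ S) ≡ S * S * k
Vr≡b⇒m²≡S²k {S} {T} {k} Vr≡b = trans (sym (square (T ∸ S))) (trans Vr≡b (cong (_* k) (square S)))

T+S≡S² : ∀ {S T g} → 1 ≤ g → 1 ≤ S → S ≤ T → (T ∸ S) ^ 2 ≡ S ^ 2 * (1 + 6 * g) →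
  T + S ≤ S * S → T + 3 ≤ 3 * S + 6 * g → T + S ≡ S * S
T+S≡S² {S} {T} {g} 1≤g 1≤S S≤T Vr≡b T+S≤S² T+3≤ =
  trans (sym ([T∸S]+2S≡T+S S≤T)) (square-gap {S} {T ∸ S} {1 + 6 * g} 1≤S 7≤1+6g (Vr≡b⇒m²≡S²k {S} {T} Vr≡b)
    (≤-trans (≤-reflexive ([T∸S]+2S≡T+S S≤T)) T+S≤S²) m+4≤2S+k)
  where
  open ≤-Reasoning
  7≤1+6g : 7 ≤ 1 + 6 * g
  7≤1+6g = +-monoʳ-≤ 1 (*-monoʳ-≤ 6 1≤g)
  m+4≤2S+k : T ∸ S + 4 ≤ 2 * S + (1 + 6 * g)
  m+4≤2S+k = +-cancelˡ-≤ (S + 3) _ _ (begin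
    S + 3 + (T ∸ S + 4)              ≡⟨ rearrange S (T ∸ S) ⟩
    S + (T ∸ S) + 3 + 4              ≡⟨ cong (λ x → x + 3 + 4) (m+[n∸m]≡n S≤T) ⟩
    T + 3 + 4                        ≤⟨ +-monoˡ-≤ 4 T+3≤ ⟩
    3 * S + 6 * g + 4                ≡⟨ rearrange′ S g ⟩
    S + 3 + (2 * S + (1 + 6 * g))    ∎)
    where
    rearrange : ∀ S m → S + 3 + (m + 4) ≡ S + m + 3 + 4
    rearrange = solve-∀
    rearrange′ : ∀ S g → 3 * S + 6 * g + 4 ≡ S + 3 + (2 * S + (1 + 6 * g))
    rearrange′ = solve-∀

-- With m = T − S, T + S = S² gives m = S(S − 2), and then m² = S²(1 + 6g) gives 1 + 6g = (S − 2)².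
genus-from-square : ∀ {S T g} → 1 ≤ S → S ≤ T → (T ∸ S) ^ 2 ≡ S ^ 2 * (1 + 6 * g) → T + S ≡ S * S →
  (6 * g ≡ (S ∸ 1) * (S ∸ 3)) × OneOrThreeMod6 S × (3 * S + 6 * g ≡ T + 3)
genus-from-square {S} {T} {g} 1≤S S≤T Vr≡b T+S≡S²
  with square-root {S} {T ∸ S} {1 + 6 * g} 1≤S (sym (trans ([T∸S]+2S≡T+S S≤T) T+S≡S²)) (Vr≡b⇒m²≡S²k {S} {T} Vr≡b)
... | zero  , refl , _    , ()
... | suc u , refl , m≡St , k≡t² = 6g≡[S∸1][S∸3] , t²%6≡1⇒OneOrThreeMod6[2+t] (suc u) t²%6≡1 , 3S+6g≡T+3
  where
  6g≡[S∸1][S∸3] : 6 * g ≡ (2 + u) * u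
  6g≡[S∸1][S∸3] = +-cancelˡ-≡ 1 _ _ (trans k≡t² (expand u))
    where
    expand : ∀ u → suc u * suc u ≡ 1 + (2 + u) * u
    expand = solve-∀
  t²%6≡1 : (suc u * suc u) % 6 ≡ 1
  t²%6≡1 = trans (cong (_% 6) (trans (sym k≡t²) (cong suc (*-comm 6 g)))) ([m+kn]%n≡m%n 1 g 6)
  3S+6g≡T+3 : 3 * (3 + u) + 6 * g ≡ T + 3
  3S+6g≡T+3 = begin
    3 * (3 + u) + 6 * g                ≡⟨ cong (3 * (3 + u) +_) 6g≡[S∸1][S∸3] ⟩
    3 * (3 + u) + (2 + u) * u          ≡⟨ expand u ⟩
    3 + u + (3 + u) * suc u + 3        ≡⟨ cong (λ m → 3 + u + m + 3) m≡St ⟨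
    3 + u + (T ∸ (3 + u)) + 3          ≡⟨ cong (_+ 3) (m+[n∸m]≡n S≤T) ⟩
    T + 3                              ∎
    where
    open ≡-Reasoning
    expand : ∀ u → 3 * (3 + u) + (2 + u) * u ≡ 3 + u + (3 + u) * suc u + 3
    expand = solve-∀

genus-arithmetic : ∀ {S T A F g} → 1 ≤ g → 1 ≤ S → S ≤ T → (T ∸ S) ^ 2 ≡ S ^ 2 * (1 + 6 * g) →
  T + S ≤ S * S → T ≤ 2 * A → 3 * F ≤ A + 3 → S + F + 2 * g ≡ A + 2 →
  (T + S ≡ S * S) × (T ≡ 2 * A) × (3 * F ≡ A + 3) × (6 * g ≡ (S ∸ 1) * (S ∸ 3)) × OneOrThreeMod6 S
genus-arithmetic {S} {T} {A} {F} {g} 1≤g 1≤S S≤T Vr≡b T+S≤S² T≤2A 3F≤A+3 euler =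
  T+S≡S*S , T≡2A , 3F≡A+3 {S} {A} {F} {g} euler (trans (cong (_+ 3) (sym T≡2A)) (sym 3S+6g≡T+3)) ,
  6g≡[S∸1][S∸3] , S≡1∨3
  where
  2A+3≤ : 2 * A + 3 ≤ 3 * S + 6 * g
  2A+3≤ = 2A+3≤3S+6g {S} {A} {F} {g} 3F≤A+3 euler
  T+S≡S*S : T + S ≡ S * S
  T+S≡S*S = T+S≡S² {S} {T} {g} 1≤g 1≤S S≤T Vr≡b T+S≤S² (≤-trans (+-monoˡ-≤ 3 T≤2A) 2A+3≤)
  genus : (6 * g ≡ (S ∸ 1) * (S ∸ 3)) × OneOrThreeMod6 S × (3 * S + 6 * g ≡ T + 3)
  genus = genus-from-square {S} {T} {g} 1≤S S≤T Vr≡b T+S≡S*S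
  6g≡[S∸1][S∸3] : 6 * g ≡ (S ∸ 1) * (S ∸ 3)
  6g≡[S∸1][S∸3] = proj₁ genus
  S≡1∨3 : OneOrThreeMod6 S
  S≡1∨3 = proj₁ (proj₂ genus)
  3S+6g≡T+3 : 3 * S + 6 * g ≡ T + 3
  3S+6g≡T+3 = proj₂ (proj₂ genus)
  T≡2A : T ≡ 2 * A
  T≡2A = ≤-antisym T≤2A (+-cancelʳ-≤ 3 _ _ (≤-trans 2A+3≤ (≤-reflexive 3S+6g≡T+3)))

-- Faces

module _ {S A g : ℕ} (G : EmbeddedGraph S A g) where
  open EmbeddedGraph G

  rev-involutive : ∀ (d : Dart A) → rev (rev d) ≡ d
  rev-involutive (e , b) = cong (e ,_) (not-involutive b)

  τ-injective : Injective _≡_ _≡_ (τ G)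
  τ-injective {d} {d′} eq = begin
    d                   ≡⟨ sym (rev-involutive d) ⟩
    rev (rev d)         ≡⟨ cong rev (sym (σ⁻¹σ (rev d))) ⟩
    rev (σ⁻¹ (σ (rev d)))  ≡⟨ cong (rev ∘ σ⁻¹) eq ⟩
    rev (σ⁻¹ (σ (rev d′))) ≡⟨ cong rev (σ⁻¹σ (rev d′)) ⟩
    rev (rev d′)        ≡⟨ rev-involutive d′ ⟩
    d′                  ∎
    where open ≡-Reasoning

  ∈-dartList : ∀ d → d ∈ dartList G
  ∈-dartList (e , b) = ∈-concatMap⁺ _ (Any.map (λ { refl → ∈-pair b }) (∈-allFin e))
    where
    ∈-pair : ∀ b → (e , b) ∈ (e , true) ∷ (e , false) ∷ []
    ∈-pair true  = here refl
    ∈-pair false = there (here refl)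

  sum-map-dartList : ∀ (h : Dart A → ℕ) → sum (map h (dartList G)) ≡ ∑[ e < A ] (h (e , true) + h (e , false))
  sum-map-dartList h = trans (sum-map-concatMap h _ (allFin A))
    (trans (sum-map-tabulate {n = A} (λ e → sum (map h ((e , true) ∷ (e , false) ∷ []))) (λ e → e))
           (sum-cong-≗ {A} λ e → cong (h (e , true) +_) (+-identityʳ _)))

  edgeCount : (Dart A → Bool) → Fin A → ℕ
  edgeCount p e = ⟦ p (e , true) ⟧ + ⟦ p (e , false) ⟧

  count-dartList : ∀ p → count p (dartList G) ≡ ∑[ e < A ] edgeCount p e
  count-dartList p = sum-map-dartList (λ d → ⟦ p d ⟧)

  count-dartList≤2A : ∀ p → count p (dartList G) ≤ 2 * A
  count-dartList≤2A p = begin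
    count p (dartList G)    ≡⟨ count-dartList p ⟩
    ∑[ e < A ] edgeCount p e ≤⟨ ∑-mono-≤ {A} (λ e → +-mono-≤ (⟦⟧≤1 (p (e , true))) (⟦⟧≤1 (p (e , false)))) ⟩
    ∑[ e < A ] 2             ≡⟨ ∑-const A 2 ⟩
    A * 2                    ≡⟨ *-comm A 2 ⟩
    2 * A                    ∎
    where open ≤-Reasoning

  _≟ᵈ_ : DecidableEquality (Dart A)
  _≟ᵈ_ = ≡-dec _≟_ _≟ᵇ_

  face-iter : ∀ k d → face (iter (τ G) k d) ≡ face d
  face-iter k d = sym (Equivalence.from (faceOrbits d _) (k , refl))

  inFace : Fin F → Dart A → Bool
  inFace f d = ⌊ face d ≟ f ⌋

  -- The fibres of face are the τ-orbits, so faceSize (face d) is the length of the left walk through d.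
  faceSize : Fin F → ℕ
  faceSize f = count (inFace f) (dartList G)

  ∑-faceSize : ∑[ f < F ] faceSize f ≡ 2 * A
  ∑-faceSize = begin
    ∑[ f < F ] faceSize f
      ≡⟨ ∑-sum-map-comm (λ f d → ⟦ inFace f d ⟧) (dartList G) ⟩
    sum (map (λ d → ∑[ f < F ] ⟦ inFace f d ⟧) (dartList G))
      ≡⟨ cong sum (map-cong (λ d → ∑-select (face d) (λ _ → 1)) (dartList G)) ⟩
    sum (map (λ _ → 1) (dartList G))
      ≡⟨ sum-map-dartList (λ _ → 1) ⟩
    ∑[ e < A ] 2
      ≡⟨ ∑-const A 2 ⟩
    A * 2
      ≡⟨ *-comm A 2 ⟩
    2 * A ∎
    where open ≡-Reasoning

  NoPeriodBelow⇒≤faceSize : ∀ {n d} → NoPeriodBelow (τ G) n d → n ≤ faceSize (face d)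
  NoPeriodBelow⇒≤faceSize {n} {d} noPeriod =
    injective⇒≤count _≟ᵈ_ (λ (i : Fin n) → iter (τ G) (toℕ i) d) (iterates-injective τ-injective noPeriod)
      (λ i → ⌊⌋-true (face _ ≟ face d) (face-iter (toℕ i) d)) (λ _ → ∈-dartList _)

  faceSize≡⇒closed : ∀ {n d} → NoPeriodBelow (τ G) n d → faceSize (face d) ≡ n → iter (τ G) n d ≡ d
  faceSize≡⇒closed {n} {d} noPeriod size≡n with iter (τ G) n d ≟ᵈ d
  ... | yes closed = closed
  ... | no open′ = ⊥-elim (<-irrefl (sym size≡n) (NoPeriodBelow⇒≤faceSize noPeriod′))
    where
    noPeriod′ : NoPeriodBelow (τ G) (suc n) d
    noPeriod′ p 0<p p<1+n with m≤n⇒m<n∨m≡n (s≤s⁻¹ p<1+n)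
    ... | inj₁ p<n  = noPeriod p 0<p p<n
    ... | inj₂ refl = open′

  NoLeftWalkOfLength1or2⇒NoPeriodBelow3 : NoLeftWalkOfLength1or2 G → ∀ d → NoPeriodBelow (τ G) 3 d
  NoLeftWalkOfLength1or2⇒NoPeriodBelow3 noShort d 1 _ _ = proj₁ (noShort d)
  NoLeftWalkOfLength1or2⇒NoPeriodBelow3 noShort d 2 _ _ = proj₂ (noShort d)
  NoLeftWalkOfLength1or2⇒NoPeriodBelow3 noShort d (suc (suc (suc _))) _ (s≤s (s≤s (s≤s ())))

  3≤faceSize : NoLeftWalkOfLength1or2 G → ∀ f → 3 ≤ faceSize f
  3≤faceSize noShort f with faceSurj f
  ... | d , refl = NoPeriodBelow⇒≤faceSize (NoLeftWalkOfLength1or2⇒NoPeriodBelow3 noShort d)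

  faceSize≡3⇒LeftWalkLength3 : NoLeftWalkOfLength1or2 G → ∀ d → faceSize (face d) ≡ 3 → LeftWalkLength3 G d
  faceSize≡3⇒LeftWalkLength3 noShort d size≡3 =
    proj₁ (noShort d) , proj₂ (noShort d) , faceSize≡⇒closed (NoLeftWalkOfLength1or2⇒NoPeriodBelow3 noShort d) size≡3

  sameFace⇒complete : ∀ {d d₀} → face d ≡ face d₀ → CompleteLeftWalk G d₀ → CompleteLeftWalk G d
  sameFace⇒complete {d} {d₀} same complete e with Equivalence.to (faceOrbits d d₀) same | complete e
  ... | k , d→d₀ | j , edge≡e = j + k , trans (cong edgeOf (trans (iter-+ (τ G) j k d) (cong (iter (τ G) j) d→d₀))) edge≡e

  complete⇒1≤edgeCount : ∀ {d} → CompleteLeftWalk G d → ∀ e → 1 ≤ edgeCount (inFace (face d)) e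
  complete⇒1≤edgeCount {d} complete e with complete e
  ... | k , refl = visited (proj₂ (iter (τ G) k d)) (⌊⌋-true (face _ ≟ face d) (face-iter k d))
    where
    visited : ∀ b → inFace (face d) (edgeOf (iter (τ G) k d) , b) ≡ true →
      1 ≤ edgeCount (inFace (face d)) (edgeOf (iter (τ G) k d))
    visited true  inside rewrite inside = s≤s z≤n
    visited false inside rewrite inside = m≤n+m 1 _

  complete⇒A≤faceSize : ∀ {d} → CompleteLeftWalk G d → A ≤ faceSize (face d)
  complete⇒A≤faceSize {d} complete = begin
    A                                          ≡⟨ sym (*-identityʳ A) ⟩
    A * 1                                      ≡⟨ sym (∑-const A 1) ⟩
    ∑[ e < A ] 1                                ≤⟨ ∑-mono-≤ {A} (complete⇒1≤edgeCount complete) ⟩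
    ∑[ e < A ] edgeCount (inFace (face d)) e    ≡⟨ sym (count-dartList (inFace (face d))) ⟩
    faceSize (face d)                           ∎
    where open ≤-Reasoning

  -- The edges of a complete walk of period q are all among its first q edges.
  complete∧closed⇒A≤ : ∀ {d q} → CompleteLeftWalk G d → iter (τ G) (suc q) d ≡ d → A ≤ suc q
  complete∧closed⇒A≤ {d} {q} complete closed = injective⇒≤ {f = position} position-injective
    where
    position : Fin A → Fin (suc q)
    position e = fromℕ< (m%n<n (proj₁ (complete e)) (suc q))

    edge-at-position : ∀ e → edgeOf (iter (τ G) (toℕ (position e)) d) ≡ e
    edge-at-position e = begin
      edgeOf (iter (τ G) (toℕ (position e)) d)
        ≡⟨ cong (λ k → edgeOf (iter (τ G) k d)) (toℕ-fromℕ< (m%n<n (proj₁ (complete e)) (suc q))) ⟩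
      edgeOf (iter (τ G) (proj₁ (complete e) % suc q) d) ≡⟨ cong edgeOf (iter-% (τ G) closed (proj₁ (complete e))) ⟨
      edgeOf (iter (τ G) (proj₁ (complete e)) d)         ≡⟨ proj₂ (complete e) ⟩
      e                                                  ∎
      where open ≡-Reasoning

    position-injective : Injective _≡_ _≡_ position
    position-injective {e} {e′} eq =
      trans (sym (edge-at-position e)) (trans (cong (λ r → edgeOf (iter (τ G) (toℕ r) d)) eq) (edge-at-position e′))

  complete⇒NoPeriodBelowA : ∀ {d} → CompleteLeftWalk G d → NoPeriodBelow (τ G) A d
  complete⇒NoPeriodBelowA complete (suc q) _ q<A closed = <⇒≱ q<A (complete∧closed⇒A≤ complete closed)

  edgeCount≡1⇒unique : ∀ {p e b b′} → edgeCount p e ≡ 1 → p (e , b) ≡ true → p (e , b′) ≡ true → b ≡ b′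
  edgeCount≡1⇒unique {b = true}  {true}  _ _ _ = refl
  edgeCount≡1⇒unique {b = false} {false} _ _ _ = refl
  edgeCount≡1⇒unique {p} {e} {true}  {false} one pt pf =
    case trans (sym one) (cong₂ (λ a b → ⟦ a ⟧ + ⟦ b ⟧) pt pf) of λ ()
  edgeCount≡1⇒unique {p} {e} {false} {true}  one pf pt =
    case trans (sym one) (cong₂ (λ a b → ⟦ a ⟧ + ⟦ b ⟧) pt pf) of λ ()

  edgeCount≡1⇒edgeOf-injective : ∀ {p} → (∀ e → edgeCount p e ≡ 1) →
    ∀ {x y} → p x ≡ true → p y ≡ true → edgeOf x ≡ edgeOf y → x ≡ y
  edgeCount≡1⇒edgeOf-injective {p} one {e , b} {.e , b′} px py refl = cong (e ,_) (edgeCount≡1⇒unique {p} (one e) px py)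

  complete⇒Eulerian : ∀ {d} → CompleteLeftWalk G d → faceSize (face d) ≡ A → EulerianLeftWalk G d
  complete⇒Eulerian {d} complete size≡A = faceSize≡⇒closed noPeriod size≡A , edges-injective
    where
    noPeriod : NoPeriodBelow (τ G) A d
    noPeriod = complete⇒NoPeriodBelowA complete

    oneDartPerEdge : ∀ e → edgeCount (inFace (face d)) e ≡ 1
    oneDartPerEdge e = sym (∑-mono-≤-≡⇒≗ {A} {λ _ → 1} (complete⇒1≤edgeCount complete) (begin
      ∑[ e < A ] 1                              ≡⟨ ∑-const A 1 ⟩
      A * 1                                    ≡⟨ *-identityʳ A ⟩
      A                                        ≡⟨ size≡A ⟨
      faceSize (face d)                        ≡⟨ count-dartList (inFace (face d)) ⟩
      ∑[ e < A ] edgeCount (inFace (face d)) e ∎) e)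
      where open ≡-Reasoning

    onFace : ∀ k → inFace (face d) (iter (τ G) k d) ≡ true
    onFace k = ⌊⌋-true (face _ ≟ face d) (face-iter k d)

    edges-injective : ∀ (i j : Fin A) → edgeOf (iter (τ G) (toℕ i) d) ≡ edgeOf (iter (τ G) (toℕ j) d) → i ≡ j
    edges-injective i j sameEdge = iterates-injective τ-injective noPeriod
      (edgeCount≡1⇒edgeOf-injective {inFace (face d)} oneDartPerEdge (onFace (toℕ i)) (onFace (toℕ j)) sameEdge)

  -- The face sizes forced by equality in 3F ≤ A + 3: A for the face f₀, 3 for all the others.
  faceSizeProfile : Fin F → Fin F → ℕ
  faceSizeProfile f₀ f = if ⌊ f₀ ≟ f ⌋ then A else 3

  profile≤faceSize : ∀ {f₀} → A ≤ faceSize f₀ → (∀ f → 3 ≤ faceSize f) →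
    ∀ f → faceSizeProfile f₀ f ≤ faceSize f
  profile≤faceSize {f₀} A≤size 3≤size f with f₀ ≟ f
  ... | yes refl = A≤size
  ... | no _     = 3≤size f

  ∑-faceSizeProfile : ∀ f₀ → ∑[ f < F ] faceSizeProfile f₀ f + 3 ≡ A + 3 * F
  ∑-faceSizeProfile f₀ = trans (∑-select-or-const f₀ A 3) (cong (A +_) (*-comm F 3))

  2A+3≡A+[A+3] : 2 * A + 3 ≡ A + (A + 3)
  2A+3≡A+[A+3] = trans (cong (λ x → A + x + 3) (+-identityʳ A)) (+-assoc A A 3)

  3F≤A+3 : ∀ {f₀} → A ≤ faceSize f₀ → (∀ f → 3 ≤ faceSize f) → 3 * F ≤ A + 3
  3F≤A+3 {f₀} A≤size 3≤size = +-cancelˡ-≤ A _ _ (begin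
    A + 3 * F                              ≡⟨ ∑-faceSizeProfile f₀ ⟨
    ∑[ f < F ] faceSizeProfile f₀ f + 3    ≤⟨ +-monoˡ-≤ 3 (∑-mono-≤ {F} (profile≤faceSize A≤size 3≤size)) ⟩
    ∑[ f < F ] faceSize f + 3              ≡⟨ cong (_+ 3) ∑-faceSize ⟩
    2 * A + 3                              ≡⟨ 2A+3≡A+[A+3] ⟩
    A + (A + 3)                            ∎)
    where open ≤-Reasoning

  3F≡A+3⇒faceSize≡profile : ∀ {f₀} → A ≤ faceSize f₀ → (∀ f → 3 ≤ faceSize f) → 3 * F ≡ A + 3 →
    ∀ f → faceSize f ≡ faceSizeProfile f₀ f
  3F≡A+3⇒faceSize≡profile {f₀} A≤size 3≤size 3F≡A+3 f =
    sym (∑-mono-≤-≡⇒≗ {F} (profile≤faceSize A≤size 3≤size) (+-cancelʳ-≡ 3 _ _ (begin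
      ∑[ f < F ] faceSizeProfile f₀ f + 3    ≡⟨ ∑-faceSizeProfile f₀ ⟩
      A + 3 * F                              ≡⟨ cong (A +_) 3F≡A+3 ⟩
      A + (A + 3)                            ≡⟨ 2A+3≡A+[A+3] ⟨
      2 * A + 3                              ≡⟨ cong (_+ 3) ∑-faceSize ⟨
      ∑[ f < F ] faceSize f + 3              ∎)) f)
    where open ≡-Reasoning

  3F≡A+3⇒faceSize≡A : ∀ {f₀} → A ≤ faceSize f₀ → (∀ f → 3 ≤ faceSize f) → 3 * F ≡ A + 3 →
    faceSize f₀ ≡ A
  3F≡A+3⇒faceSize≡A {f₀} A≤size 3≤size 3F≡A+3 =
    trans (3F≡A+3⇒faceSize≡profile A≤size 3≤size 3F≡A+3 f₀) (cong (if_then A else 3) (⌊⌋-true (f₀ ≟ f₀) refl))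

  3F≡A+3⇒faceSize≡3 : ∀ {f₀ f} → A ≤ faceSize f₀ → (∀ f → 3 ≤ faceSize f) → 3 * F ≡ A + 3 → f₀ ≢ f →
    faceSize f ≡ 3
  3F≡A+3⇒faceSize≡3 {f₀} {f} A≤size 3≤size 3F≡A+3 f₀≢f =
    trans (3F≡A+3⇒faceSize≡profile A≤size 3≤size 3F≡A+3 f) (cong (if_then A else 3) (⌊⌋-false (f₀ ≟ f) f₀≢f))

  -- The reduced graph

  adjacentB⇒Adjacent : ∀ {u v} → adjacentB G u v ≡ true → Adjacent G u v
  adjacentB⇒Adjacent {u} {v} adj with Any.satisfied (any⁻ _ (dartList G) (Equivalence.from T-≡ adj))
  ... | d , joined with Equivalence.to (T-∧ {⌊ src d ≟ u ⌋}) joined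
  ...   | from-u , to-v = d , toWitness {a? = src d ≟ u} from-u , toWitness {a? = src (rev d) ≟ v} to-v

  adjacentPair : Fin S → Fin S → Bool
  adjacentPair u v = not ⌊ u ≟ v ⌋ ∧ adjacentB G u v

  twoAr≡∑∑ : twoAr G ≡ ∑[ u < S ] ∑[ v < S ] ⟦ adjacentPair u v ⟧
  twoAr≡∑∑ = trans (sum-map-cartesianProduct (λ p → ⟦ adjacentPair (proj₁ p) (proj₂ p) ⟧) (allFin S) (allFin S))
    (trans (sum-map-tabulate {n = S} (λ u → sum (map (λ v → ⟦ adjacentPair u v ⟧) (allFin S))) (λ u → u))
           (sum-cong-≗ {S} λ u → sum-map-tabulate {n = S} (λ v → ⟦ adjacentPair u v ⟧) (λ v → v)))

  ⟦adjacentPair⟧≤⟦≢⟧ : ∀ u v → ⟦ adjacentPair u v ⟧ ≤ ⟦ not ⌊ u ≟ v ⌋ ⟧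
  ⟦adjacentPair⟧≤⟦≢⟧ u v = ⟦∧⟧≤⟦⟧ (not ⌊ u ≟ v ⌋) _

  twoAr+S≤S*S : twoAr G + S ≤ S * S
  twoAr+S≤S*S = begin
    twoAr G + S                                     ≡⟨ cong (_+ S) twoAr≡∑∑ ⟩
    ∑[ u < S ] ∑[ v < S ] ⟦ adjacentPair u v ⟧ + S
      ≤⟨ +-monoˡ-≤ S (∑-mono-≤ {S} λ u → ∑-mono-≤ {S} (⟦adjacentPair⟧≤⟦≢⟧ u)) ⟩
    ∑[ u < S ] ∑[ v < S ] ⟦ not ⌊ u ≟ v ⌋ ⟧ + S      ≡⟨ ∑∑-⟦≢⟧ S ⟩
    S * S                                           ∎
    where open ≤-Reasoning

  twoAr+S≡S*S⇒adjacent : twoAr G + S ≡ S * S → ∀ u v → u ≢ v → Adjacent G u v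
  twoAr+S≡S*S⇒adjacent eq u v u≢v =
    adjacentB⇒Adjacent (∧-conicalʳ _ _ (⟦⟧≡1⇒true (trans pointwise (cong (⟦_⟧ ∘ not) (⌊⌋-false (u ≟ v) u≢v)))))
    where
    pointwise : ⟦ adjacentPair u v ⟧ ≡ ⟦ not ⌊ u ≟ v ⌋ ⟧
    pointwise = ∑∑-mono-≤-≡⇒≗ {S} {S} ⟦adjacentPair⟧≤⟦≢⟧
      (+-cancelʳ-≡ S _ _ (trans (cong (_+ S) (sym twoAr≡∑∑)) (trans eq (sym (∑∑-⟦≢⟧ S))))) u v

  joins : Fin S → Fin S → Dart A → Bool
  joins u v d = ⌊ src d ≟ u ⌋ ∧ (⌊ src (rev d) ≟ v ⌋ ∧ not ⌊ u ≟ v ⌋)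

  isNonLoop : Dart A → Bool
  isNonLoop d = not ⌊ src d ≟ src (rev d) ⌋

  joins-true : ∀ {u v d} → src d ≡ u → src (rev d) ≡ v → u ≢ v → joins u v d ≡ true
  joins-true {u} {v} {d} from-u to-v u≢v
    rewrite ⌊⌋-true (src d ≟ u) from-u | ⌊⌋-true (src (rev d) ≟ v) to-v | ⌊⌋-false (u ≟ v) u≢v = refl

  ∑∑-joins : ∀ d → ∑[ u < S ] ∑[ v < S ] ⟦ joins u v d ⟧ ≡ ⟦ isNonLoop d ⟧
  ∑∑-joins d = begin
    ∑[ u < S ] ∑[ v < S ] ⟦ joins u v d ⟧
      ≡⟨ sum-cong-≗ {S} (λ u → trans (sum-cong-≗ {S} λ v → ⟦∧⟧ ⌊ src d ≟ u ⌋ _)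
                                      (∑-if {S} ⌊ src d ≟ u ⌋ (λ v → ⟦ ⌊ src (rev d) ≟ v ⌋ ∧ not ⌊ u ≟ v ⌋ ⟧))) ⟩
    ∑[ u < S ] (if ⌊ src d ≟ u ⌋ then ∑[ v < S ] ⟦ ⌊ src (rev d) ≟ v ⌋ ∧ not ⌊ u ≟ v ⌋ ⟧ else 0)
      ≡⟨ ∑-select (src d) _ ⟩
    ∑[ v < S ] ⟦ ⌊ src (rev d) ≟ v ⌋ ∧ not ⌊ src d ≟ v ⌋ ⟧
      ≡⟨ sum-cong-≗ {S} (λ v → ⟦∧⟧ ⌊ src (rev d) ≟ v ⌋ _) ⟩
    ∑[ v < S ] (if ⌊ src (rev d) ≟ v ⌋ then ⟦ not ⌊ src d ≟ v ⌋ ⟧ else 0)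
      ≡⟨ ∑-select (src (rev d)) _ ⟩
    ⟦ isNonLoop d ⟧ ∎
    where open ≡-Reasoning

  ∑∑-count-joins : ∑[ u < S ] ∑[ v < S ] count (joins u v) (dartList G) ≡ count isNonLoop (dartList G)
  ∑∑-count-joins = begin
    ∑[ u < S ] ∑[ v < S ] count (joins u v) (dartList G)
      ≡⟨ sum-cong-≗ {S} (λ u → ∑-sum-map-comm (λ v d → ⟦ joins u v d ⟧) (dartList G)) ⟩
    ∑[ u < S ] sum (map (λ d → ∑[ v < S ] ⟦ joins u v d ⟧) (dartList G))
      ≡⟨ ∑-sum-map-comm (λ u d → ∑[ v < S ] ⟦ joins u v d ⟧) (dartList G) ⟩
    sum (map (λ d → ∑[ u < S ] ∑[ v < S ] ⟦ joins u v d ⟧) (dartList G))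
      ≡⟨ cong sum (map-cong ∑∑-joins (dartList G)) ⟩
    count isNonLoop (dartList G) ∎
    where open ≡-Reasoning

  ⟦adjacentPair⟧≤count-joins : ∀ u v → ⟦ adjacentPair u v ⟧ ≤ count (joins u v) (dartList G)
  ⟦adjacentPair⟧≤count-joins u v = ⟦⟧≤ λ adjacent →
    let u≢v = not⌊⌋-true⁻ (u ≟ v) (∧-conicalˡ _ _ adjacent)
        d , from-u , to-v = adjacentB⇒Adjacent (∧-conicalʳ _ _ adjacent)
    in true⇒1≤count (dartList G) (∈-dartList d) (joins-true from-u to-v u≢v)

  twoAr≤nonLoops : twoAr G ≤ count isNonLoop (dartList G)
  twoAr≤nonLoops = begin
    twoAr G                                              ≡⟨ twoAr≡∑∑ ⟩
    ∑[ u < S ] ∑[ v < S ] ⟦ adjacentPair u v ⟧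
      ≤⟨ ∑-mono-≤ {S} (λ u → ∑-mono-≤ {S} (⟦adjacentPair⟧≤count-joins u)) ⟩
    ∑[ u < S ] ∑[ v < S ] count (joins u v) (dartList G) ≡⟨ ∑∑-count-joins ⟩
    count isNonLoop (dartList G)                         ∎
    where open ≤-Reasoning

  twoAr≤2A : twoAr G ≤ 2 * A
  twoAr≤2A = ≤-trans twoAr≤nonLoops (count-dartList≤2A isNonLoop)

  twoAr≡2A⇒nonLoops≡2A : twoAr G ≡ 2 * A → count isNonLoop (dartList G) ≡ 2 * A
  twoAr≡2A⇒nonLoops≡2A eq = ≤-antisym (count-dartList≤2A isNonLoop) (≤-trans (≤-reflexive (sym eq)) twoAr≤nonLoops)

  twoAr≡2A⇒⟦adjacentPair⟧≡count-joins : twoAr G ≡ 2 * A →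
    ∀ u v → ⟦ adjacentPair u v ⟧ ≡ count (joins u v) (dartList G)
  twoAr≡2A⇒⟦adjacentPair⟧≡count-joins eq = ∑∑-mono-≤-≡⇒≗ {S} {S} ⟦adjacentPair⟧≤count-joins (begin
    ∑[ u < S ] ∑[ v < S ] ⟦ adjacentPair u v ⟧            ≡⟨ twoAr≡∑∑ ⟨
    twoAr G                                              ≡⟨ trans eq (sym (twoAr≡2A⇒nonLoops≡2A eq)) ⟩
    count isNonLoop (dartList G)                         ≡⟨ ∑∑-count-joins ⟨
    ∑[ u < S ] ∑[ v < S ] count (joins u v) (dartList G) ∎)
    where open ≡-Reasoning

  edgeCount≡2⇒first : ∀ {p : Dart A → Bool} {e} → ⟦ p (e , true) ⟧ + ⟦ p (e , false) ⟧ ≡ 2 → p (e , true) ≡ true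
  edgeCount≡2⇒first {p} {e} two with p (e , true)
  ... | true  = refl
  ... | false = ⊥-elim (<-irrefl two (s≤s (⟦⟧≤1 (p (e , false)))))

  twoAr≡2A⇒loopless : twoAr G ≡ 2 * A → ∀ e → src (e , true) ≢ src (e , false)
  twoAr≡2A⇒loopless eq e = not⌊⌋-true⁻ (src (e , true) ≟ src (e , false)) (edgeCount≡2⇒first {isNonLoop} two)
    where
    two : edgeCount isNonLoop e ≡ 2
    two = ∑-mono-≤-≡⇒≗ {A} {edgeCount isNonLoop} {λ _ → 2}
      (λ e → +-mono-≤ (⟦⟧≤1 (isNonLoop (e , true))) (⟦⟧≤1 (isNonLoop (e , false))))
      (begin
        ∑[ e < A ] edgeCount isNonLoop e  ≡⟨ count-dartList isNonLoop ⟨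
        count isNonLoop (dartList G)      ≡⟨ twoAr≡2A⇒nonLoops≡2A eq ⟩
        2 * A                             ≡⟨ *-comm 2 A ⟩
        A * 2                             ≡⟨ ∑-const A 2 ⟨
        ∑[ e < A ] 2                      ∎) e
      where open ≡-Reasoning

  parallelDart : ∀ {e e′ : Fin A} →
    (src (e , true) ≡ src (e′ , true)) × (src (e , false) ≡ src (e′ , false))
    ⊎ (src (e , true) ≡ src (e′ , false)) × (src (e , false) ≡ src (e′ , true))
    → ∃ λ y → edgeOf y ≡ e′ × src y ≡ src (e , true) × src (rev y) ≡ src (e , false)
  parallelDart {e′ = e′} (inj₁ (same-src , same-tgt)) = (e′ , true)  , refl , sym same-src , sym same-tgt
  parallelDart {e′ = e′} (inj₂ (same-src , same-tgt)) = (e′ , false) , refl , sym same-src , sym same-tgt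

  -- Two parallel edges would give two darts from u to v, against ⟦ adjacentPair u v ⟧ ≤ 1.
  twoAr≡2A⇒noParallel : twoAr G ≡ 2 * A → ∀ (e e′ : Fin A) →
    (src (e , true) ≡ src (e′ , true)) × (src (e , false) ≡ src (e′ , false))
    ⊎ (src (e , true) ≡ src (e′ , false)) × (src (e , false) ≡ src (e′ , true))
    → e ≡ e′
  twoAr≡2A⇒noParallel eq e e′ sameEnds with e ≟ e′ | parallelDart sameEnds
  ... | yes e≡e′ | _ = e≡e′
  ... | no e≢e′  | y , refl , from-u , to-v = ⊥-elim (<-irrefl refl (begin-strict
      1                                                  <⟨ two-darts ⟩
      count (joins u v) (dartList G)                     ≡⟨ twoAr≡2A⇒⟦adjacentPair⟧≡count-joins eq u v ⟨
      ⟦ adjacentPair u v ⟧                               ≤⟨ ⟦⟧≤1 _ ⟩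
      1                                                  ∎))
    where
    open ≤-Reasoning
    u = src (e , true)
    v = src (e , false)
    u≢v : u ≢ v
    u≢v = twoAr≡2A⇒loopless eq e
    two-darts : 2 ≤ count (joins u v) (dartList G)
    two-darts = distinct⇒2≤count _≟ᵈ_ (dartList G) (∈-dartList (e , true)) (∈-dartList y)
      (e≢e′ ∘ cong proj₁) (joins-true refl refl u≢v) (joins-true from-u to-v u≢v)

  twoAr≡2A⇒IsCompleteGraph : twoAr G ≡ 2 * A → twoAr G + S ≡ S * S → IsCompleteGraph G
  twoAr≡2A⇒IsCompleteGraph twoAr≡2A twoAr+S≡S*S =
    twoAr≡2A⇒loopless twoAr≡2A , twoAr≡2A⇒noParallel twoAr≡2A , twoAr+S≡S*S⇒adjacent twoAr+S≡S*S

proposition6p1 : ∀ (g S A : ℕ) (G : EmbeddedGraph S A g) →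
    1 ≤ g →
    HasCompleteLeftWalk G →
    NoLeftWalkOfLength1or2 G →
    VrEqualsB G →
    IsCompleteGraph G
    × ((S % 6 ≡ 1) ⊎ (S % 6 ≡ 3))
    × (6 * g ≡ (S ∸ 1) * (S ∸ 3))
    × (∀ d → CompleteLeftWalk G d → EulerianLeftWalk G d)
    × (∀ d → ¬ CompleteLeftWalk G d → LeftWalkLength3 G d)
proposition6p1 g S A G 1≤g (d₀ , complete₀) noShort (S≤T , Vr≡b) =
  twoAr≡2A⇒IsCompleteGraph G twoAr≡2A twoAr+S≡S*S , S≡1∨3 , 6g≡[S∸1][S∸3] , eulerian , length3
  where
  open EmbeddedGraph G using (F; face; src; euler)

  3≤size : ∀ f → 3 ≤ faceSize G f
  3≤size = 3≤faceSize G noShort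

  A≤size₀ : A ≤ faceSize G (face d₀)
  A≤size₀ = complete⇒A≤faceSize G complete₀

  arithmetic : (twoAr G + S ≡ S * S) × (twoAr G ≡ 2 * A) × (3 * F ≡ A + 3)
    × (6 * g ≡ (S ∸ 1) * (S ∸ 3)) × OneOrThreeMod6 S
  arithmetic = genus-arithmetic 1≤g (>-nonZero⁻¹ S {{nonZeroIndex (src d₀)}}) S≤T Vr≡b
    (twoAr+S≤S*S G) (twoAr≤2A G) (3F≤A+3 G A≤size₀ 3≤size) euler

  twoAr+S≡S*S : twoAr G + S ≡ S * S
  twoAr+S≡S*S = proj₁ arithmetic
  twoAr≡2A : twoAr G ≡ 2 * A
  twoAr≡2A = proj₁ (proj₂ arithmetic)
  faces-tight : 3 * F ≡ A + 3
  faces-tight = proj₁ (proj₂ (proj₂ arithmetic))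
  6g≡[S∸1][S∸3] : 6 * g ≡ (S ∸ 1) * (S ∸ 3)
  6g≡[S∸1][S∸3] = proj₁ (proj₂ (proj₂ (proj₂ arithmetic)))
  S≡1∨3 : OneOrThreeMod6 S
  S≡1∨3 = proj₂ (proj₂ (proj₂ (proj₂ arithmetic)))

  eulerian : ∀ d → CompleteLeftWalk G d → EulerianLeftWalk G d
  eulerian d complete = complete⇒Eulerian G complete
    (3F≡A+3⇒faceSize≡A G (complete⇒A≤faceSize G complete) 3≤size faces-tight)

  length3 : ∀ d → ¬ CompleteLeftWalk G d → LeftWalkLength3 G d
  length3 d incomplete = faceSize≡3⇒LeftWalkLength3 G noShort d
    (3F≡A+3⇒faceSize≡3 G A≤size₀ 3≤size faces-tight (λ same → incomplete (sameFace⇒complete G (sym same) complete₀)))
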